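{- Regard every finite simple graph as a weighted graph with all vertex weights equal to $1$, and let $W_G(q_1,q_2,\dots)$ be its weighted chromatic polynomial. Then for every simple graph $G$ and every pair of distinct vertices $a,b$ of $G$, $$W_G-W_{G'_{ab}}=W_{\widetilde{G}_{ab}}-W_{\widetilde{G}'_{ab}}.$$
   Context: A weighted graph is a simple graph with a positive integer weight assigned to each vertex. The weighted chromatic polynomial is the unique invariant of weighted graphs $G\mapsto W_G\in\mathbb{C}[q_1,q_2,\dots]$ such that: (i) for the graph with one vertex of weight $n$, $W=q_n$; (ii) $W_{G_1\sqcup G_2}=W_{G_1}W_{G_2}$ for disjoint unions; (iii) for every edge $e$, $W_G=W_{G'_e}+W_{G''_e}$, where $G'_e$ is $G$ with $e$ deleted and $G''_e$ is $G$ with $e$ contracted (the two ends merged into one vertex whose weight is the sum of their weights, and any resulting multiple edges replaced by single edges). For vertices $a\ne b$ of a simple graph $G$: $G'_{ab}$ is obtained by switching the adjacency between $a$ and $b$; $\widetilde{G}_{ab}$ is obtained by switching the adjacency of $a$ with every vertex $v\ne a$ adjacent to $b$; $\widetilde{G}'_{ab}$ is the result of applying both operations. -}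

module Defs where

open import Level using (Level)
open import Data.Nat as ℕ using (ℕ; zero; suc; _≤_)
open import Data.Nat.Properties using (≤-trans; m≤m+n)
open import Data.Fin as Fin using (Fin; splitAt; punchIn)
open import Data.Fin.Permutation using (Permutation′; _⟨$⟩ʳ_)
open import Data.Bool using (Bool; true; false; _∧_; _∨_; not; _xor_; if_then_else_)
open import Data.Sum using (inj₁; inj₂)
open import Relation.Nullary using (¬_)
open import Relation.Nullary.Decidable using (⌊_⌋)
open import Relation.Binary.PropositionalEquality using (_≡_)
open import Algebra.Bundles using (CommutativeRing)

_=ᵛ_ : ∀ {n} → Fin n → Fin n → Bool
x =ᵛ y = ⌊ x Fin.≟ y ⌋

-- Weighted graphs on the vertex set Fin n.
-- 'rel' is an arbitrary Boolean relation; the actual (simple) adjacency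
-- is its symmetric, irreflexive part 'Adj' below.  Weights are positive.

record WGraph (n : ℕ) : Set where
  field
    weight   : Fin n → ℕ
    positive : ∀ x → 1 ≤ weight x
    rel      : Fin n → Fin n → Bool

open WGraph public

Adj : ∀ {n} → WGraph n → Fin n → Fin n → Bool
Adj G x y = not (x =ᵛ y) ∧ (rel G x y ∨ rel G y x)

UnitWeights : ∀ {n} → WGraph n → Set
UnitWeights {n} G = ∀ (x : Fin n) → weight G x ≡ 1

IsIsoVia : ∀ {n} → Permutation′ n → WGraph n → WGraph n → Set
IsIsoVia σ H G =
  (∀ x → weight H x ≡ weight G (σ ⟨$⟩ʳ x)) ×'
  (∀ x y → Adj H x y ≡ Adj G (σ ⟨$⟩ʳ x) (σ ⟨$⟩ʳ y))
  where
  open import Data.Product using () renaming (_×_ to _×'_)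

single : (k : ℕ) → 1 ≤ k → WGraph 1
single k p = record { weight = λ _ → k ; positive = λ _ → p ; rel = λ _ _ → false }

_⊕_ : ∀ {m n} → WGraph m → WGraph n → WGraph (m ℕ.+ n)
_⊕_ {m} G H = record
  { weight   = w
  ; positive = pos
  ; rel      = r
  }
  where
  w : Fin _ → ℕ
  w x with splitAt m x
  ... | inj₁ a = weight G a
  ... | inj₂ b = weight H b
  pos : ∀ x → 1 ≤ w x
  pos x with splitAt m x
  ... | inj₁ a = positive G a
  ... | inj₂ b = positive H b
  r : Fin _ → Fin _ → Bool
  r x y with splitAt m x | splitAt m y
  ... | inj₁ a | inj₁ b = Adj G a b
  ... | inj₂ a | inj₂ b = Adj H a b
  ... | _      | _      = false

isPair : ∀ {n} → Fin n → Fin n → Fin n → Fin n → Bool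
isPair i j x y = (x =ᵛ i ∧ y =ᵛ j) ∨ (x =ᵛ j ∧ y =ᵛ i)

deleteEdge : ∀ {n} → WGraph n → Fin n → Fin n → WGraph n
deleteEdge G i j = record
  { weight = weight G ; positive = positive G
  ; rel = λ x y → Adj G x y ∧ not (isPair i j x y) }

-- G''_e : contract the edge {i , j}: vertex j is removed (the remaining
-- vertices are relabelled by punchIn j), vertex i receives weight
-- w(i) + w(j) and all neighbours of j; multiple edges become single edges.
contractEdge : ∀ {m} → WGraph (suc m) → Fin (suc m) → Fin (suc m) → WGraph m
contractEdge G i j = record
  { weight   = w
  ; positive = λ x → ≤-trans (positive G (punchIn j x)) (m≤m+n _ _)
  ; rel      = λ x y → Adj G (punchIn j x) (punchIn j y)
                       ∨ (punchIn j x =ᵛ i ∧ Adj G j (punchIn j y))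
                       ∨ (punchIn j y =ᵛ i ∧ Adj G (punchIn j x) j)
  }
  where
  w : Fin _ → ℕ
  w x = weight G (punchIn j x) ℕ.+ (if punchIn j x =ᵛ i then weight G j else 0)

-- G'_{ab}: switch the adjacency between a and b
switchPair : ∀ {n} → WGraph n → Fin n → Fin n → WGraph n
switchPair G a b = record
  { weight = weight G ; positive = positive G
  ; rel = λ x y → Adj G x y xor isPair a b x y }

-- G~_{ab}: switch the adjacency of a with every vertex v ≠ a adjacent to b
switchNbhd : ∀ {n} → WGraph n → Fin n → Fin n → WGraph n
switchNbhd G a b = record
  { weight = weight G ; positive = positive G
  ; rel = λ x y → Adj G x y xor
            ((x =ᵛ a ∧ not (y =ᵛ a) ∧ Adj G b y)
             ∨ (y =ᵛ a ∧ not (x =ᵛ a) ∧ Adj G b x)) }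

-- G~'_{ab}: both operations
switchBoth : ∀ {n} → WGraph n → Fin n → Fin n → WGraph n
switchBoth G a b = switchPair (switchNbhd G a b) a b

-- The defining properties (i)-(iii) of the weighted chromatic polynomial,
-- for a map W from weighted graphs to a commutative ring R in which the
-- variables q_1, q_2, ... are interpreted by q.

record IsWeightedChromatic {c ℓ : Level} (R : CommutativeRing c ℓ)
       (q : ℕ → CommutativeRing.Carrier R)
       (W : ∀ n → WGraph n → CommutativeRing.Carrier R) : Set (c Level.⊔ ℓ) where
  open CommutativeRing R
  field
    invariant : ∀ n (σ : Permutation′ n) (G H : WGraph n) →
                IsIsoVia σ H G → W n H ≈ W n G
    vertex    : ∀ k (p : 1 ≤ k) → W 1 (single k p) ≈ q k
    union     : ∀ m n (G : WGraph m) (H : WGraph n) →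
                W (m ℕ.+ n) (G ⊕ H) ≈ W m G * W n H
    delCon    : ∀ m (G : WGraph (suc m)) (i j : Fin (suc m)) →
                Adj G i j ≡ true →
                W (suc m) G ≈ W (suc m) (deleteEdge G i j) + W m (contractEdge G i j)

-- Deletion–contraction along ab gives W G − W G' = ± W (G/ab), with sign + if ab is an edge of G
-- and − otherwise (in the second case apply it to G', whose switch is G again).  Passing from G
-- to G̃ changes neither whether ab is an edge nor the contraction G/ab: the merged vertex is
-- adjacent to N(a) ∪ N(b) in G, and to (N(a) △ N(b)) ∪ N(b) = N(a) ∪ N(b) in G̃.
module Submission where

open import Defs
open import Level using (Level)
open import Data.Nat as ℕ using (ℕ; zero; suc)
open import Data.Fin using (Fin; punchIn; _≟_)
open import Data.Fin.Properties using (punchInᵢ≢i; punchIn-injective)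
open import Data.Fin.Permutation using () renaming (id to idₚ)
open import Data.Bool using (Bool; T; true; false; _∧_; _∨_; not; _xor_; if_then_else_)
open import Data.Bool.Properties
  using (∨-comm; ∧-comm; ∨-idem; ∨-identityʳ; ∧-identityʳ; xor-identityʳ; xor-same; xor-assoc; ¬-not; T-≡; T-∧; T-∨)
open import Data.Product as Product using (_×_; _,_; proj₂)
open import Data.Sum as Sum using (_⊎_; inj₁; inj₂; [_,_]′)
open import Function using (_∘_)
open import Function.Bundles using (Equivalence)
open import Relation.Nullary.Decidable using (toWitness; fromWitness; toSum)
open import Relation.Binary.PropositionalEquality hiding (setoid)
open import Algebra.Bundles using (CommutativeRing)
import Algebra.Properties.AbelianGroup as AbelianGroupProperties
import Relation.Binary.Reasoning.Setoid as SetoidReasoning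

private
  variable
    n : ℕ

=ᵛ⇒≡ : {x y : Fin n} → (x =ᵛ y) ≡ true → x ≡ y
=ᵛ⇒≡ = toWitness ∘ Equivalence.from T-≡

=ᵛ-≡ : {x y : Fin n} → x ≡ y → (x =ᵛ y) ≡ true
=ᵛ-≡ = Equivalence.to T-≡ ∘ fromWitness

=ᵛ-≢ : {x y : Fin n} → x ≢ y → (x =ᵛ y) ≡ false
=ᵛ-≢ x≢y = ¬-not (x≢y ∘ =ᵛ⇒≡)

=ᵛ-sym : (x y : Fin n) → (x =ᵛ y) ≡ (y =ᵛ x)
=ᵛ-sym x y with toSum (x ≟ y)
... | inj₁ x≡y = trans (=ᵛ-≡ x≡y) (sym (=ᵛ-≡ (sym x≡y)))
... | inj₂ x≢y = trans (=ᵛ-≢ x≢y) (sym (=ᵛ-≢ (x≢y ∘ sym)))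

xor-∨-absorb : ∀ p q → (p xor q) ∨ q ≡ p ∨ q
xor-∨-absorb true  true  = refl
xor-∨-absorb true  false = refl
xor-∨-absorb false q     = ∨-idem q

∧-not≡xor : ∀ p q → (q ≡ true → p ≡ true) → p ∧ not q ≡ p xor q
∧-not≡xor p false _   = trans (∧-identityʳ p) (sym (xor-identityʳ p))
∧-not≡xor p true  q⇒p rewrite q⇒p refl = refl

Adj-sym : (H : WGraph n) (x y : Fin n) → Adj H x y ≡ Adj H y x
Adj-sym H x y = cong₂ (λ s t → not s ∧ t) (=ᵛ-sym x y) (∨-comm (rel H x y) (rel H y x))

Adj-irrefl : (H : WGraph n) (x : Fin n) → Adj H x x ≡ false
Adj-irrefl H x = cong (λ s → not s ∧ (rel H x x ∨ rel H x x)) (=ᵛ-≡ refl)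

Adj-of-symmetric-rel : (H : WGraph n) → (∀ x y → rel H x y ≡ rel H y x) →
                       ∀ {x y} → x ≢ y → Adj H x y ≡ rel H x y
Adj-of-symmetric-rel H rel-sym {x} {y} x≢y =
  trans (cong₂ (λ s t → not s ∧ (rel H x y ∨ t)) (=ᵛ-≢ x≢y) (rel-sym y x)) (∨-idem (rel H x y))

infix 4 _≈ᴳ_

-- H and K are the same weighted simple graph; their raw relations 'rel' may still differ.
record _≈ᴳ_ (H K : WGraph n) : Set where
  field
    weight-≡ : ∀ x → weight H x ≡ weight K x
    Adj-≡    : ∀ {x y} → x ≢ y → Adj H x y ≡ Adj K x y

open _≈ᴳ_

≈ᴳ⇒IsIsoVia-id : {H K : WGraph n} → H ≈ᴳ K → IsIsoVia idₚ H K
≈ᴳ⇒IsIsoVia-id {H = H} {K} H≈K = weight-≡ H≈K , Adj-≡′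
  where
  Adj-≡′ : ∀ x y → Adj H x y ≡ Adj K x y
  Adj-≡′ x y with toSum (x ≟ y)
  ... | inj₁ refl = trans (Adj-irrefl H x) (sym (Adj-irrefl K x))
  ... | inj₂ x≢y  = Adj-≡ H≈K x≢y

isPair-sym : (a b x y : Fin n) → isPair a b x y ≡ isPair a b y x
isPair-sym a b x y = trans (∨-comm (x =ᵛ a ∧ y =ᵛ b) (x =ᵛ b ∧ y =ᵛ a))
  (cong₂ _∨_ (∧-comm (x =ᵛ b) (y =ᵛ a)) (∧-comm (x =ᵛ a) (y =ᵛ b)))

isPair-self : (a b : Fin n) → isPair a b a b ≡ true
isPair-self a b = cong (_∨ (a =ᵛ b ∧ b =ᵛ a)) (cong₂ _∧_ (=ᵛ-≡ {x = a} refl) (=ᵛ-≡ {x = b} refl))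

isPair⇒ : {a b x y : Fin n} → isPair a b x y ≡ true → (x ≡ a × y ≡ b) ⊎ (x ≡ b × y ≡ a)
isPair⇒ = Sum.map both both ∘ Equivalence.to T-∨ ∘ Equivalence.from T-≡
  where
  both : {u v w z : Fin n} → T ((u =ᵛ v) ∧ (w =ᵛ z)) → u ≡ v × w ≡ z
  both {u = u} {v} {w} {z} =
    Product.map (toWitness {a? = u ≟ v}) (toWitness {a? = w ≟ z}) ∘ Equivalence.to (T-∧ {u =ᵛ v} {w =ᵛ z})

isPair-∉ʳ : {a b x y : Fin n} → y ≢ a → y ≢ b → isPair a b x y ≡ false
isPair-∉ʳ {a = a} {b} {x} {y} y≢a y≢b =
  ¬-not ([ y≢b ∘ proj₂ , y≢a ∘ proj₂ ]′ ∘ isPair⇒ {a = a} {b} {x} {y})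

Adj-switchPair : (H : WGraph n) {a b x y : Fin n} → x ≢ y →
                 Adj (switchPair H a b) x y ≡ Adj H x y xor isPair a b x y
Adj-switchPair H {a} {b} = Adj-of-symmetric-rel (switchPair H a b)
  λ x y → cong₂ _xor_ (Adj-sym H x y) (isPair-sym a b x y)

Adj-switchPair-∉ʳ : (H : WGraph n) {a b x y : Fin n} → y ≢ a → y ≢ b → x ≢ y →
                    Adj (switchPair H a b) x y ≡ Adj H x y
Adj-switchPair-∉ʳ H {a} {b} {x} {y} y≢a y≢b x≢y =
  trans (Adj-switchPair H x≢y)
        (trans (cong (Adj H x y xor_) (isPair-∉ʳ {x = x} y≢a y≢b)) (xor-identityʳ (Adj H x y)))

Adj-switchPair-nonadjacent : (H : WGraph n) {a b : Fin n} → a ≢ b → Adj H a b ≡ false →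
                             Adj (switchPair H a b) a b ≡ true
Adj-switchPair-nonadjacent H {a} {b} a≢b ab-false =
  trans (Adj-switchPair H a≢b) (cong₂ _xor_ ab-false (isPair-self a b))

switchPair-involutive : (H : WGraph n) (a b : Fin n) → switchPair (switchPair H a b) a b ≈ᴳ H
switchPair-involutive H a b = record
  { weight-≡ = λ _ → refl
  ; Adj-≡    = λ {x} {y} x≢y → let p = isPair a b x y in begin
      Adj (switchPair (switchPair H a b) a b) x y ≡⟨ Adj-switchPair (switchPair H a b) x≢y ⟩
      Adj (switchPair H a b) x y xor p            ≡⟨ cong (_xor p) (Adj-switchPair H x≢y) ⟩
      (Adj H x y xor p) xor p                     ≡⟨ xor-assoc (Adj H x y) p p ⟩
      Adj H x y xor (p xor p)                     ≡⟨ cong (Adj H x y xor_) (xor-same p) ⟩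
      Adj H x y xor false                         ≡⟨ xor-identityʳ (Adj H x y) ⟩
      Adj H x y                                   ∎
  }
  where open ≡-Reasoning

deleteEdge≈switchPair : (H : WGraph n) {a b : Fin n} → Adj H a b ≡ true →
                        deleteEdge H a b ≈ᴳ switchPair H a b
deleteEdge≈switchPair H {a} {b} ab-true = record
  { weight-≡ = λ _ → refl
  ; Adj-≡    = λ {x} {y} x≢y →
      trans (Adj-of-symmetric-rel (deleteEdge H a b)
               (λ x y → cong₂ (λ s t → s ∧ not t) (Adj-sym H x y) (isPair-sym a b x y)) x≢y)
        (trans (∧-not≡xor (Adj H x y) (isPair a b x y) (λ e → trans (isPair⇒Adj≡ e) ab-true))
               (sym (Adj-switchPair H x≢y)))
  }
  where
  isPair⇒Adj≡ : ∀ {x y} → isPair a b x y ≡ true → Adj H x y ≡ Adj H a b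
  isPair⇒Adj≡ {x} {y} e with isPair⇒ {a = a} {b} {x} {y} e
  ... | inj₁ (refl , refl) = refl
  ... | inj₂ (refl , refl) = Adj-sym H b a

nbhdToggle : WGraph n → Fin n → Fin n → Fin n → Fin n → Bool
nbhdToggle H a b x y = (x =ᵛ a ∧ not (y =ᵛ a) ∧ Adj H b y) ∨ (y =ᵛ a ∧ not (x =ᵛ a) ∧ Adj H b x)

Adj-switchNbhd : (H : WGraph n) {a b x y : Fin n} → x ≢ y →
                 Adj (switchNbhd H a b) x y ≡ Adj H x y xor nbhdToggle H a b x y
Adj-switchNbhd H {a} {b} = Adj-of-symmetric-rel (switchNbhd H a b) λ x y →
  cong₂ _xor_ (Adj-sym H x y)
    (∨-comm (x =ᵛ a ∧ not (y =ᵛ a) ∧ Adj H b y) (y =ᵛ a ∧ not (x =ᵛ a) ∧ Adj H b x))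

Adj-switchNbhd-away : (H : WGraph n) {a b x y : Fin n} → x ≢ a → y ≢ a → x ≢ y →
                      Adj (switchNbhd H a b) x y ≡ Adj H x y
Adj-switchNbhd-away H {a} {b} {x} {y} x≢a y≢a x≢y = begin
  Adj (switchNbhd H a b) x y          ≡⟨ Adj-switchNbhd H x≢y ⟩
  Adj H x y xor nbhdToggle H a b x y  ≡⟨ cong (Adj H x y xor_) toggle-off ⟩
  Adj H x y xor false                 ≡⟨ xor-identityʳ (Adj H x y) ⟩
  Adj H x y                           ∎
  where
  open ≡-Reasoning
  toggle-off : nbhdToggle H a b x y ≡ false
  toggle-off rewrite =ᵛ-≢ x≢a | =ᵛ-≢ y≢a = refl

Adj-switchNbhd-at : (H : WGraph n) {a b y : Fin n} → y ≢ a →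
                    Adj (switchNbhd H a b) a y ≡ Adj H a y xor Adj H b y
Adj-switchNbhd-at H {a} {b} {y} y≢a =
  trans (Adj-switchNbhd H (y≢a ∘ sym)) (cong (Adj H a y xor_) toggle-on)
  where
  toggle-on : nbhdToggle H a b a y ≡ Adj H b y
  toggle-on rewrite =ᵛ-≡ (refl {x = a}) | =ᵛ-≢ y≢a = ∨-identityʳ (Adj H b y)

Adj-switchNbhd-pair : (H : WGraph n) {a b : Fin n} → a ≢ b →
                      Adj (switchNbhd H a b) a b ≡ Adj H a b
Adj-switchNbhd-pair H {a} {b} a≢b =
  trans (Adj-switchNbhd-at H (a≢b ∘ sym))
        (trans (cong (Adj H a b xor_) (Adj-irrefl H b)) (xor-identityʳ (Adj H a b)))

-- Adjacency in the contraction between the images of u, v ≠ b, on the labels of the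
-- uncontracted graph; a stands for the merged vertex.
mergedAdj : WGraph n → Fin n → Fin n → Fin n → Fin n → Bool
mergedAdj H a b u v = Adj H u v ∨ (u =ᵛ a ∧ Adj H b v) ∨ (v =ᵛ a ∧ Adj H u b)

mergedAdj-sym : (H : WGraph n) (a b u v : Fin n) → mergedAdj H a b u v ≡ mergedAdj H a b v u
mergedAdj-sym H a b u v = cong₂ _∨_ (Adj-sym H u v)
  (trans (∨-comm (u =ᵛ a ∧ Adj H b v) (v =ᵛ a ∧ Adj H u b))
    (cong₂ _∨_ (cong (v =ᵛ a ∧_) (Adj-sym H u b)) (cong (u =ᵛ a ∧_) (Adj-sym H b v))))

mergedAdj-at : (H : WGraph n) {a b v : Fin n} → v ≢ a →
               mergedAdj H a b a v ≡ Adj H a v ∨ Adj H b v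
mergedAdj-at H {a} {b} {v} v≢a
  rewrite =ᵛ-≡ (refl {x = a}) | =ᵛ-≢ v≢a = cong (Adj H a v ∨_) (∨-identityʳ (Adj H b v))

mergedAdj-away : (H : WGraph n) {a b u v : Fin n} → u ≢ a → v ≢ a →
                 mergedAdj H a b u v ≡ Adj H u v
mergedAdj-away H {a} {b} {u} {v} u≢a v≢a
  rewrite =ᵛ-≢ u≢a | =ᵛ-≢ v≢a = ∨-identityʳ (Adj H u v)

mergedAdj-cong : (H K : WGraph n) {a b : Fin n} →
  (∀ {v} → v ≢ a → v ≢ b → Adj H a v ∨ Adj H b v ≡ Adj K a v ∨ Adj K b v) →
  (∀ {u v} → u ≢ a → v ≢ a → u ≢ b → v ≢ b → u ≢ v → Adj H u v ≡ Adj K u v) →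
  ∀ {u v} → u ≢ b → v ≢ b → u ≢ v → mergedAdj H a b u v ≡ mergedAdj K a b u v
mergedAdj-cong H K {a} {b} at-a away {u} {v} u≢b v≢b u≢v with toSum (u ≟ a) | toSum (v ≟ a)
... | inj₁ refl | _ = begin
  mergedAdj H u b u v       ≡⟨ mergedAdj-at H (u≢v ∘ sym) ⟩
  Adj H u v ∨ Adj H b v     ≡⟨ at-a (u≢v ∘ sym) v≢b ⟩
  Adj K u v ∨ Adj K b v     ≡⟨ mergedAdj-at K (u≢v ∘ sym) ⟨
  mergedAdj K u b u v       ∎
  where open ≡-Reasoning
... | inj₂ u≢a | inj₁ refl = begin
  mergedAdj H v b u v       ≡⟨ mergedAdj-sym H v b u v ⟩
  mergedAdj H v b v u       ≡⟨ mergedAdj-at H u≢a ⟩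
  Adj H v u ∨ Adj H b u     ≡⟨ at-a u≢a u≢b ⟩
  Adj K v u ∨ Adj K b u     ≡⟨ mergedAdj-at K u≢a ⟨
  mergedAdj K v b v u       ≡⟨ mergedAdj-sym K v b v u ⟩
  mergedAdj K v b u v       ∎
  where open ≡-Reasoning
... | inj₂ u≢a | inj₂ v≢a = begin
  mergedAdj H a b u v       ≡⟨ mergedAdj-away H u≢a v≢a ⟩
  Adj H u v                 ≡⟨ away u≢a v≢a u≢b v≢b u≢v ⟩
  Adj K u v                 ≡⟨ mergedAdj-away K u≢a v≢a ⟨
  mergedAdj K a b u v       ∎
  where open ≡-Reasoning

Adj-contractEdge : {m : ℕ} (H : WGraph (suc m)) {a b : Fin (suc m)} {x y : Fin m} → x ≢ y →
  Adj (contractEdge H a b) x y ≡ mergedAdj H a b (punchIn b x) (punchIn b y)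
Adj-contractEdge H {a} {b} = Adj-of-symmetric-rel (contractEdge H a b)
  λ x y → mergedAdj-sym H a b (punchIn b x) (punchIn b y)

contractEdge-cong : {m : ℕ} (H K : WGraph (suc m)) {a b : Fin (suc m)} →
  (∀ x → weight H x ≡ weight K x) →
  (∀ {u v} → u ≢ b → v ≢ b → u ≢ v → mergedAdj H a b u v ≡ mergedAdj K a b u v) →
  contractEdge H a b ≈ᴳ contractEdge K a b
contractEdge-cong H K {a} {b} same-weight same-merged = record
  { weight-≡ = λ x → cong₂ ℕ._+_ (same-weight (punchIn b x))
                 (cong (if punchIn b x =ᵛ a then_else 0) (same-weight b))
  ; Adj-≡    = λ {x} {y} x≢y →
      trans (Adj-contractEdge H {a} {b} x≢y)
        (trans (same-merged (punchInᵢ≢i b x) (punchInᵢ≢i b y) (x≢y ∘ punchIn-injective b x y))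
               (sym (Adj-contractEdge K {a} {b} x≢y)))
  }

contractEdge-switchPair : {m : ℕ} (H : WGraph (suc m)) (a b : Fin (suc m)) →
  contractEdge (switchPair H a b) a b ≈ᴳ contractEdge H a b
contractEdge-switchPair H a b = contractEdge-cong (switchPair H a b) H (λ _ → refl)
  (mergedAdj-cong (switchPair H a b) H at-a away)
  where
  at-a : ∀ {v} → v ≢ a → v ≢ b →
         Adj (switchPair H a b) a v ∨ Adj (switchPair H a b) b v ≡ Adj H a v ∨ Adj H b v
  at-a v≢a v≢b = cong₂ _∨_ (Adj-switchPair-∉ʳ H v≢a v≢b (v≢a ∘ sym))
                           (Adj-switchPair-∉ʳ H v≢a v≢b (v≢b ∘ sym))
  away : ∀ {u v} → u ≢ a → v ≢ a → u ≢ b → v ≢ b → u ≢ v →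
         Adj (switchPair H a b) u v ≡ Adj H u v
  away _ v≢a _ v≢b u≢v = Adj-switchPair-∉ʳ H v≢a v≢b u≢v

contractEdge-switchNbhd : {m : ℕ} (H : WGraph (suc m)) {a b : Fin (suc m)} → a ≢ b →
  contractEdge (switchNbhd H a b) a b ≈ᴳ contractEdge H a b
contractEdge-switchNbhd H {a} {b} a≢b = contractEdge-cong (switchNbhd H a b) H (λ _ → refl)
  (mergedAdj-cong (switchNbhd H a b) H at-a away)
  where
  at-a : ∀ {v} → v ≢ a → v ≢ b →
         Adj (switchNbhd H a b) a v ∨ Adj (switchNbhd H a b) b v ≡ Adj H a v ∨ Adj H b v
  at-a {v} v≢a v≢b = begin
    Adj (switchNbhd H a b) a v ∨ Adj (switchNbhd H a b) b v
      ≡⟨ cong₂ _∨_ (Adj-switchNbhd-at H v≢a) (Adj-switchNbhd-away H (a≢b ∘ sym) v≢a (v≢b ∘ sym)) ⟩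
    (Adj H a v xor Adj H b v) ∨ Adj H b v
      ≡⟨ xor-∨-absorb (Adj H a v) (Adj H b v) ⟩
    Adj H a v ∨ Adj H b v ∎
    where open ≡-Reasoning
  away : ∀ {u v} → u ≢ a → v ≢ a → u ≢ b → v ≢ b → u ≢ v →
         Adj (switchNbhd H a b) u v ≡ Adj H u v
  away u≢a v≢a _ _ u≢v = Adj-switchNbhd-away H u≢a v≢a u≢v

module _ {c ℓ : Level} {R : CommutativeRing c ℓ} {q : ℕ → CommutativeRing.Carrier R}
         {W : ∀ n → WGraph n → CommutativeRing.Carrier R} (isW : IsWeightedChromatic R q W) where

  open CommutativeRing R
    using (_≈_; _+_; _-_; -_; +-comm; +-congʳ; +-congˡ; -‿cong; setoid; +-abelianGroup)
  open AbelianGroupProperties +-abelianGroup using (//-rightDividesʳ; ⁻¹-anti-homo‿-)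
  open IsWeightedChromatic isW
  open SetoidReasoning setoid

  W-cong : {H K : WGraph n} → H ≈ᴳ K → W n H ≈ W n K
  W-cong {n} {H} {K} H≈K = invariant n idₚ K H (≈ᴳ⇒IsIsoVia-id H≈K)

  private
    x≈y+z⇒x-y≈z : ∀ {x y z} → x ≈ y + z → x - y ≈ z
    x≈y+z⇒x-y≈z {x} {y} {z} x≈y+z = begin
      x - y        ≈⟨ +-congʳ x≈y+z ⟩
      (y + z) - y  ≈⟨ +-congʳ (+-comm y z) ⟩
      (z + y) - y  ≈⟨ //-rightDividesʳ y z ⟩
      z            ∎

  switchPair-difference-adjacent : {m : ℕ} (H : WGraph (suc m)) {a b : Fin (suc m)} →
    Adj H a b ≡ true →
    W (suc m) H - W (suc m) (switchPair H a b) ≈ W m (contractEdge H a b)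
  switchPair-difference-adjacent {m} H {a} {b} ab-true = x≈y+z⇒x-y≈z (begin
    W (suc m) H
      ≈⟨ delCon m H a b ab-true ⟩
    W (suc m) (deleteEdge H a b) + W m (contractEdge H a b)
      ≈⟨ +-congʳ (W-cong (deleteEdge≈switchPair H ab-true)) ⟩
    W (suc m) (switchPair H a b) + W m (contractEdge H a b) ∎)

  switchPair-difference-nonadjacent : {m : ℕ} (H : WGraph (suc m)) {a b : Fin (suc m)} →
    a ≢ b → Adj H a b ≡ false →
    W (suc m) H - W (suc m) (switchPair H a b) ≈ - W m (contractEdge H a b)
  switchPair-difference-nonadjacent {m} H {a} {b} a≢b ab-false = begin
    W (suc m) H - W (suc m) H′
      ≈⟨ ⁻¹-anti-homo‿- (W (suc m) H′) (W (suc m) H) ⟨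
    - (W (suc m) H′ - W (suc m) H)
      ≈⟨ -‿cong (+-congˡ (-‿cong (W-cong (switchPair-involutive H a b)))) ⟨
    - (W (suc m) H′ - W (suc m) (switchPair H′ a b))
      ≈⟨ -‿cong (switchPair-difference-adjacent H′ (Adj-switchPair-nonadjacent H a≢b ab-false)) ⟩
    - W m (contractEdge H′ a b)
      ≈⟨ -‿cong (W-cong (contractEdge-switchPair H a b)) ⟩
    - W m (contractEdge H a b) ∎
    where H′ = switchPair H a b

  switchPair-difference-cong : {m : ℕ} (H K : WGraph (suc m)) {a b : Fin (suc m)} → a ≢ b →
    Adj H a b ≡ Adj K a b → contractEdge H a b ≈ᴳ contractEdge K a b →
    W (suc m) H - W (suc m) (switchPair H a b) ≈ W (suc m) K - W (suc m) (switchPair K a b)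
  switchPair-difference-cong {m} H K {a} {b} a≢b same-ab same-contraction with Adj H a b in ab
  ... | true = begin
    W (suc m) H - W (suc m) (switchPair H a b)  ≈⟨ switchPair-difference-adjacent H ab ⟩
    W m (contractEdge H a b)                    ≈⟨ W-cong same-contraction ⟩
    W m (contractEdge K a b)                    ≈⟨ switchPair-difference-adjacent K (sym same-ab) ⟨
    W (suc m) K - W (suc m) (switchPair K a b)  ∎
  ... | false = begin
    W (suc m) H - W (suc m) (switchPair H a b)  ≈⟨ switchPair-difference-nonadjacent H a≢b ab ⟩
    - W m (contractEdge H a b)                  ≈⟨ -‿cong (W-cong same-contraction) ⟩
    - W m (contractEdge K a b)                  ≈⟨ switchPair-difference-nonadjacent K a≢b (sym same-ab) ⟨
    W (suc m) K - W (suc m) (switchPair K a b)  ∎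

mainTheorem3 : {c ℓ : Level} (R : CommutativeRing c ℓ)
               (q : ℕ → CommutativeRing.Carrier R)
               (W : ∀ n → WGraph n → CommutativeRing.Carrier R) →
               IsWeightedChromatic R q W →
               ∀ n (G : WGraph n) → UnitWeights G →
               (a b : Fin n) → a ≢ b →
               CommutativeRing._≈_ R
                 (CommutativeRing._-_ R (W n G) (W n (switchPair G a b)))
                 (CommutativeRing._-_ R (W n (switchNbhd G a b)) (W n (switchBoth G a b)))
mainTheorem3 R q W isW zero    G _ ()
mainTheorem3 R q W isW (suc m) G _ a b a≢b =
  CommutativeRing.sym R (switchPair-difference-cong isW (switchNbhd G a b) G a≢b
    (Adj-switchNbhd-pair G a≢b) (contractEdge-switchNbhd G a≢b))
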